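{- Let $G$ be a graph and $n,m\in\mathbb{N}$ with $m<n$. If $\chi(G^{\frac{m}{n}})=\omega(G^{\frac{m}{n}})$, then $\chi(G^{\frac{m}{n+m+1}})=\omega(G^{\frac{m}{n+m+1}})$.
   Context: All graphs are finite and simple; $\chi$ is the chromatic number and $\omega$ the clique number. For a graph $H$ and $m\in\mathbb{N}$, the $m$-power $H^m$ has vertex set $V(H)$, with distinct vertices $x,y$ adjacent iff $1\le d_H(x,y)\le m$. For $n\in\mathbb{N}$, the $n$-subdivision $G^{\frac1n}$ is obtained from $G$ by replacing each edge by a path of length $n$. The fractional power $G^{\frac{m}{n}}$ is $(G^{\frac1n})^m$. -}

module Defs where

open import Data.Nat using (ℕ; zero; suc; _∸_; _≤_; _<_; _<?_)
open import Data.Fin using (Fin; fromℕ<) renaming (_<_ to _<ᶠ_)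
open import Data.Bool using (Bool; true; false)
open import Data.Product using (Σ; ∃; ∃-syntax; _×_; _,_)
open import Data.Sum using (_⊎_; inj₁; inj₂)
open import Relation.Binary.PropositionalEquality using (_≡_; _≢_)
open import Relation.Nullary using (yes; no)

record Graph : Set where
  field
    N      : ℕ
    adj    : Fin N → Fin N → Bool
    sym    : ∀ x y → adj x y ≡ adj y x
    irrefl : ∀ x → adj x x ≡ false

data Walk {V : Set} (E : V → V → Set) : ℕ → V → V → Set where
  here : ∀ {x} → Walk E 0 x x
  step : ∀ {l x y z} → E x y → Walk E l y z → Walk E (suc l) x z

Pow : {V : Set} → (V → V → Set) → ℕ → V → V → Set
Pow E m x y = x ≢ y × ∃[ l ] (l ≤ m × Walk E l x y)

Colorable : {V : Set} → (V → V → Set) → ℕ → Set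
Colorable {V} E k = Σ (V → Fin k) λ c → ∀ x y → E x y → c x ≢ c y

HasClique : {V : Set} → (V → V → Set) → ℕ → Set
HasClique {V} E k = Σ (Fin k → V) λ f → ∀ i j → i ≢ j → E (f i) (f j)

IsChromaticNumber : {V : Set} → (V → V → Set) → ℕ → Set
IsChromaticNumber E k = Colorable E k × (∀ j → Colorable E j → k ≤ j)

IsCliqueNumber : {V : Set} → (V → V → Set) → ℕ → Set
IsCliqueNumber E k = HasClique E k × (∀ j → HasClique E j → j ≤ k)

ChiEqOmega : {V : Set} → (V → V → Set) → Set
ChiEqOmega E = ∃[ k ] (IsChromaticNumber E k × IsCliqueNumber E k)

-- Each edge {x,y} (stored once, with x < y)
-- is replaced by the path x = p_0, p_1, ..., p_n = y, whose internal
-- vertices p_1..p_{n-1} are new vertices (e , i) with i : Fin (n ∸ 1)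
-- (p_{i+1} = (e , i)).

module _ (G : Graph) where
  open Graph G

  record Edge : Set where
    constructor edge
    field
      ex  : Fin N
      ey  : Fin N
      lt  : ex <ᶠ ey
      isE : adj ex ey ≡ true

  SubV : ℕ → Set
  SubV n = Fin N ⊎ (Edge × Fin (n ∸ 1))

  -- p-th vertex of the path replacing edge e (meaningful for p ≤ n).
  pt : (n : ℕ) → Edge → ℕ → SubV n
  pt n e zero = inj₁ (Edge.ex e)
  pt n e (suc k) with k <? (n ∸ 1)
  ... | yes k<n-1 = inj₂ (e , fromℕ< k<n-1)
  ... | no _      = inj₁ (Edge.ey e)

  SubAdj : (n : ℕ) → SubV n → SubV n → Set
  SubAdj n u v = ∃[ e ] ∃[ p ] (p < n ×
      ((pt n e p ≡ u × pt n e (suc p) ≡ v) ⊎ (pt n e p ≡ v × pt n e (suc p) ≡ u)))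

FracPow : (G : Graph) (m n : ℕ) → SubV G n → SubV G n → Set
FracPow G m n = Pow (SubAdj G n) m

module Submission where

-- Write G_k for the k-subdivision of G.  For m < n, a walk of length ≤ m in G_n
-- either stays inside one subdivided edge or passes through an original vertex;
-- consequently every clique of G^{m/n} lies at distance < n from a single
-- original vertex x (three vertices escaping both ends of an edge would give
-- 3n ≤ 3m).  Put n′ = n + m + 1.
--   χ(G^{m/n′}) ≤ χ(G^{m/n}): folding every subdivided edge of G_{n′} onto the
--     corresponding edge of G_n is a homomorphism G^{m/n′} → G^{m/n}.
--   ω(G^{m/n}) ≤ ω(G^{m/n′}): lengthening every edge at its end away from x
--     copies the ball of radius < n around x isometrically, clique included.
-- Hence χ(G^{m/n′}) ≤ χ(G^{m/n}) = ω(G^{m/n}) ≤ ω(G^{m/n′}) ≤ χ(G^{m/n′}).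

open import Axiom.UniquenessOfIdentityProofs using (module Decidable⇒UIP)
open import Data.Bool using () renaming (_≟_ to _≟ᵇ_)
open import Data.Empty using (⊥; ⊥-elim)
open import Data.Fin using (Fin; toℕ; fromℕ<) renaming (zero to fzero; _≟_ to _≟ᶠ_)
open import Data.Fin.Properties using (fromℕ<-toℕ; toℕ-fromℕ<; toℕ<n; toℕ-injective; injective⇒≤; all?; ¬∀⟶∃¬)
open import Data.Nat using (ℕ; zero; suc; _+_; _∸_; _≤_; _<_; _<?_; _≤?_; z≤n; s≤s; z<s)
open import Data.Nat.Tactic.RingSolver using (solve-∀)
open import Data.Nat.Properties
open import Data.Product using (∃-syntax; _×_; _,_; proj₁; proj₂)
open import Data.Product.Properties using (,-injectiveˡ; ,-injectiveʳ)
open import Data.Sum using (_⊎_; inj₁; inj₂)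
open import Data.Sum.Properties using (inj₂-injective)
open import Function using (_∘_)
open import Relation.Binary.Definitions using (Symmetric)
open import Relation.Binary.PropositionalEquality
open import Relation.Nullary using (Dec; yes; no; ¬_)

open import Defs

module _ {V : Set} {E : V → V → Set} where

  _++ʷ_ : ∀ {a b x y z} → Walk E a x y → Walk E b y z → Walk E (a + b) x z
  here     ++ʷ w′ = w′
  step s w ++ʷ w′ = step s (w ++ʷ w′)

  reverseʷ : Symmetric E → ∀ {a x y} → Walk E a x y → Walk E a y x
  reverseʷ E-sym here                = here
  reverseʷ E-sym {suc a} {x} {z} (step s w) =
    subst (λ l → Walk E l z x) (+-comm a 1) (reverseʷ E-sym w ++ʷ step (E-sym s) here)

  clique≤colours : ∀ {k j} → HasClique E k → Colorable E j → k ≤ j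
  clique≤colours (K , clique) (c , proper) = injective⇒≤ {f = c ∘ K} colour-injective
    where
    colour-injective : ∀ {a b} → c (K a) ≡ c (K b) → a ≡ b
    colour-injective {a} {b} eq with a ≟ᶠ b
    ... | yes a≡b = a≡b
    ... | no a≢b  = ⊥-elim (proper (K a) (K b) (clique a b a≢b) eq)

module _ {V W : Set} {E : V → V → Set} {F : W → W → Set} where

  Colorable-pullback : (f : W → V) → (∀ {u v} → F u v → E (f u) (f v)) → ∀ {k} → Colorable E k → Colorable F k
  Colorable-pullback f hom (c , proper) = c ∘ f , λ u v Fuv → proper (f u) (f v) (hom Fuv)

  -- χ = ω only needs some k with both a k-colouring and a k-clique, since ω ≤ χ always.
  ChiEqOmega-transfer : (∀ {k} → Colorable E k → Colorable F k) → (∀ {k} → HasClique E k → HasClique F k) →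
                        ChiEqOmega E → ChiEqOmega F
  ChiEqOmega-transfer colour clique (k , (colE , _) , (clqE , _)) =
    k , (colour colE , λ j colF → clique≤colours (clique clqE) colF) ,
        (clique clqE , λ j clqF → clique≤colours clqF (colour colE))

m<n+m+1 : ∀ n m → m < n + m + 1
m<n+m+1 n m = subst (m <_) (+-comm 1 (n + m)) (s≤s (m≤n+m m n))

module Subdivision (G : Graph) (n : ℕ) where
  open Graph G using (N)

  ex ey : Edge G → Fin N
  ex = Edge.ex
  ey = Edge.ey

  ex<ey : ∀ e → toℕ (ex e) < toℕ (ey e)
  ex<ey = Edge.lt

  Vertex : Set
  Vertex = SubV G n

  _~_ : Vertex → Vertex → Set
  _~_ = SubAdj G n

  Within : ℕ → Vertex → Vertex → Set
  Within L u v = ∃[ l ] (l ≤ L × Walk _~_ l u v)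

  ~-sym : Symmetric _~_
  ~-sym (e , p , p<n , inj₁ ends) = e , p , p<n , inj₂ ends
  ~-sym (e , p , p<n , inj₂ ends) = e , p , p<n , inj₁ ends

  ex≢ey : ∀ e → ex e ≢ ey e
  ex≢ey e eq = <-irrefl (cong toℕ eq) (ex<ey e)

  edge-≡ : ∀ {e f : Edge G} → ex e ≡ ex f → ey e ≡ ey f → e ≡ f
  edge-≡ {edge a b a<b ab} {edge .a .b a<b′ ab′} refl refl =
    cong₂ (edge a b) (<-irrelevant a<b a<b′) (Decidable⇒UIP.≡-irrelevant _≟ᵇ_ ab ab′)

  Incident : Fin N → Edge G → Set
  Incident r e = ex e ≡ r ⊎ ey e ≡ r

  incident-ends : ∀ {r s e} → r ≢ s → Incident r e → Incident s e →
                  (ex e ≡ r × ey e ≡ s) ⊎ (ex e ≡ s × ey e ≡ r)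
  incident-ends r≢s (inj₁ refl) (inj₁ refl) = ⊥-elim (r≢s refl)
  incident-ends r≢s (inj₁ p)    (inj₂ q)    = inj₁ (p , q)
  incident-ends r≢s (inj₂ p)    (inj₁ q)    = inj₂ (q , p)
  incident-ends r≢s (inj₂ refl) (inj₂ refl) = ⊥-elim (r≢s refl)

  -- Edges are stored once, with ex e < ey e, so their endpoints determine them.
  edge-unique : ∀ {r s e f} → r ≢ s → Incident r e → Incident s e → Incident r f → Incident s f → e ≡ f
  edge-unique {e = e} {f} r≢s re se rf sf with incident-ends {e = e} r≢s re se | incident-ends {e = f} r≢s rf sf
  ... | inj₁ (a , b) | inj₁ (c , d) = edge-≡ (trans a (sym c)) (trans b (sym d))
  ... | inj₂ (a , b) | inj₂ (c , d) = edge-≡ (trans a (sym c)) (trans b (sym d))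
  ... | inj₁ (refl , refl) | inj₂ (c , d) = ⊥-elim (<-asym (ex<ey e) (subst₂ (λ p q → toℕ p < toℕ q) c d (ex<ey f)))
  ... | inj₂ (refl , refl) | inj₁ (c , d) = ⊥-elim (<-asym (ex<ey e) (subst₂ (λ p q → toℕ p < toℕ q) c d (ex<ey f)))

  internal<n : (i : Fin (n ∸ 1)) → suc (toℕ i) < n
  internal<n i = <∸1⇒suc< n (toℕ<n i)
    where
    <∸1⇒suc< : ∀ n → toℕ i < n ∸ 1 → suc (toℕ i) < n
    <∸1⇒suc< (suc n) i<n = s≤s i<n

  pt-internal : ∀ e (i : Fin (n ∸ 1)) → pt G n e (suc (toℕ i)) ≡ inj₂ (e , i)
  pt-internal e i with toℕ i <? n ∸ 1
  ... | yes i<n = cong (λ j → inj₂ (e , j)) (fromℕ<-toℕ i i<n)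
  ... | no i≮n  = ⊥-elim (i≮n (toℕ<n i))

  pt-last : ∀ e k → suc k ≡ n → pt G n e (suc k) ≡ inj₁ (ey e)
  pt-last e k eq with k <? n ∸ 1
  ... | yes k<n = ⊥-elim (<-irrefl refl (subst (λ t → k < t ∸ 1) (sym eq) k<n))
  ... | no _    = refl

  pt≡internal⇒edge : ∀ e p {f i} → pt G n e p ≡ inj₂ (f , i) → e ≡ f
  pt≡internal⇒edge e zero ()
  pt≡internal⇒edge e (suc k) eq with k <? n ∸ 1
  pt≡internal⇒edge e (suc k) refl | yes _ = refl
  pt≡internal⇒edge e (suc k) ()   | no _

  internal-~⇒edge : ∀ {e i f j} → inj₂ (e , i) ~ inj₂ (f , j) → e ≡ f
  internal-~⇒edge (g , p , _ , inj₁ (a , b)) = trans (sym (pt≡internal⇒edge g p a)) (pt≡internal⇒edge g (suc p) b)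
  internal-~⇒edge (g , p , _ , inj₂ (a , b)) = trans (sym (pt≡internal⇒edge g (suc p) b)) (pt≡internal⇒edge g p a)

  -- dist r w is the distance from r to w in the subdivision, capped at n.  Seen
  -- from r, the point at position p of e (counted from ex e) is at distance
  -- p, n ∸ p or (at least) n, according as r is ex e, ey e or neither.
  offset : ∀ {A B : Set} → Dec A → Dec B → ℕ → ℕ
  offset (yes _) _       p = p
  offset (no _)  (yes _) p = n ∸ p
  offset (no _)  (no _)  _ = n

  offsetFrom : Fin N → Edge G → ℕ → ℕ
  offsetFrom r e = offset (ex e ≟ᶠ r) (ey e ≟ᶠ r)

  atVertex : ∀ {A : Set} → Dec A → ℕ
  atVertex (yes _) = 0
  atVertex (no _)  = n

  dist : Fin N → Vertex → ℕ
  dist r (inj₁ y)       = atVertex (y ≟ᶠ r)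
  dist r (inj₂ (e , i)) = offsetFrom r e (suc (toℕ i))

  dist-centre : ∀ r → dist r (inj₁ r) ≡ 0
  dist-centre r with r ≟ᶠ r
  ... | yes _ = refl
  ... | no r≢r = ⊥-elim (r≢r refl)

  dist-pt : ∀ r e p → p ≤ n → dist r (pt G n e p) ≡ offsetFrom r e p
  dist-pt r e zero _ with ex e ≟ᶠ r | ey e ≟ᶠ r
  ... | yes _ | _     = refl
  ... | no _  | yes _ = refl
  ... | no _  | no _  = refl
  dist-pt r e (suc k) k<n with k <? n ∸ 1
  ... | yes k<n-1 = cong (λ j → offsetFrom r e (suc j)) (toℕ-fromℕ< k<n-1)
  ... | no k≮n-1  = last-point (ex e ≟ᶠ r) (ey e ≟ᶠ r)
    where
    1+k≡n : suc k ≡ n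
    1+k≡n = ≤-antisym k<n (≤-trans (m≤n+m∸n n 1) (s≤s (≮⇒≥ k≮n-1)))
    last-point : (a : Dec (ex e ≡ r)) (b : Dec (ey e ≡ r)) →
                 atVertex b ≡ offset a b (suc k)
    last-point (yes a) (yes b) = ⊥-elim (ex≢ey e (trans a (sym b)))
    last-point (yes a) (no b)  = sym 1+k≡n
    last-point (no a)  (yes b) = trans (sym (n∸n≡0 n)) (cong (n ∸_) (sym 1+k≡n))
    last-point (no a)  (no b)  = refl

  offset-step : ∀ r e p → p < n →
                offsetFrom r e (suc p) ≤ suc (offsetFrom r e p) × offsetFrom r e p ≤ suc (offsetFrom r e (suc p))
  offset-step r e p p<n with ex e ≟ᶠ r | ey e ≟ᶠ r
  ... | yes _ | _     = ≤-refl , ≤-trans (n≤1+n p) (n≤1+n (suc p))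
  ... | no _  | yes _ = ≤-trans (∸-monoʳ-≤ n (n≤1+n p)) (n≤1+n (n ∸ p)) , ≤-reflexive (+-∸-assoc 1 p<n)
  ... | no _  | no _  = n≤1+n n , n≤1+n n

  dist-~ : ∀ r {u v} → u ~ v → dist r v ≤ suc (dist r u)
  dist-~ r (e , p , p<n , inj₁ (refl , refl)) =
    subst₂ (λ a b → a ≤ suc b) (sym (dist-pt r e (suc p) p<n)) (sym (dist-pt r e p (<⇒≤ p<n)))
           (proj₁ (offset-step r e p p<n))
  dist-~ r (e , p , p<n , inj₂ (refl , refl)) =
    subst₂ (λ a b → a ≤ suc b) (sym (dist-pt r e p (<⇒≤ p<n))) (sym (dist-pt r e (suc p) p<n))
           (proj₂ (offset-step r e p p<n))

  dist-walk : ∀ r {L u v} → Walk _~_ L u v → dist r v ≤ L + dist r u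
  dist-walk r here = ≤-refl
  dist-walk r {suc L} {u} (step s w) =
    ≤-trans (dist-walk r w) (≤-trans (+-monoʳ-≤ L (dist-~ r s)) (≤-reflexive (+-suc L (dist r u))))

  dist-from-centre : ∀ r {L v} → Walk _~_ L (inj₁ r) v → dist r v ≤ L
  dist-from-centre r {L} {v} w =
    subst (dist r v ≤_) (trans (cong (L +_) (dist-centre r)) (+-identityʳ L)) (dist-walk r w)

  record Through (L : ℕ) (r : Fin N) (u v : Vertex) : Set where
    constructor through
    field bound : dist r u + dist r v ≤ L

  Through-≤ : ∀ {L M r u v} → L ≤ M → Through L r u v → Through M r u v
  Through-≤ L≤M (through bound) = through (≤-trans bound L≤M)

  SameEdge : Vertex → Vertex → Set
  SameEdge u v = ∃[ e ] ∃[ i ] ∃[ j ] (u ≡ inj₂ (e , i) × v ≡ inj₂ (e , j))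

  walk-dichotomy : ∀ {L u v} → Walk _~_ L u v → SameEdge u v ⊎ ∃[ r ] Through L r u v
  walk-dichotomy {L} {inj₁ y} {v} w =
    inj₂ (y , through (subst (λ d → d + dist y v ≤ L) (sym (dist-centre y)) (dist-from-centre y w)))
  walk-dichotomy {u = inj₂ (e , i)} here = inj₁ (e , i , i , refl , refl)
  walk-dichotomy {u = inj₂ (e , i)} (step s w) with walk-dichotomy w
  ... | inj₁ (f , j , k , refl , refl) = inj₁ (f , i , k , cong (λ g → inj₂ (g , i)) (internal-~⇒edge s) , refl)
  ... | inj₂ (r , through bound) = inj₂ (r , through (≤-trans (+-monoˡ-≤ _ (dist-~ r (~-sym s))) (s≤s bound)))

  offset-from-ex : ∀ e p → offsetFrom (ex e) e p ≡ p
  offset-from-ex e p with ex e ≟ᶠ ex e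
  ... | yes _   = refl
  ... | no ≢ex = ⊥-elim (≢ex refl)

  dist-edge-ex : ∀ e i → dist (ex e) (inj₂ (e , i)) ≡ suc (toℕ i)
  dist-edge-ex e i = offset-from-ex e (suc (toℕ i))

  same-edge-walk-bound : ∀ {L e i j} → Walk _~_ L (inj₂ (e , i)) (inj₂ (e , j)) → suc (toℕ j) ≤ L + suc (toℕ i)
  same-edge-walk-bound {L} {e} {i} {j} w =
    subst₂ (λ a b → a ≤ L + b) (dist-edge-ex e j) (dist-edge-ex e i) (dist-walk (ex e) w)

  offset-two-centres : ∀ {x y r s : Fin N} (a : Dec (x ≡ r)) (b : Dec (y ≡ r)) (c : Dec (x ≡ s)) (d : Dec (y ≡ s)) →
                       r ≢ s → ∀ p → p ≤ n → n ≤ offset a b p + offset c d p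
  offset-two-centres (yes refl) _        (yes refl) _        r≢s p _   = ⊥-elim (r≢s refl)
  offset-two-centres (yes _)    _        (no _)     (yes _)  _   p p≤n = ≤-reflexive (sym (m+[n∸m]≡n p≤n))
  offset-two-centres (yes _)    _        (no _)     (no _)   _   p _   = m≤n+m n p
  offset-two-centres (no _)     (yes _)  (yes _)    _        _   p p≤n = ≤-reflexive (sym (m∸n+n≡m p≤n))
  offset-two-centres (no _)     (yes refl) (no _)   (yes refl) r≢s p _ = ⊥-elim (r≢s refl)
  offset-two-centres (no _)     (yes _)  (no _)     (no _)   _   p _   = m≤n+m n (n ∸ p)
  offset-two-centres (no _)     (no _)   _          _        _   p _   = m≤m+n n _

  dist-two-centres : ∀ {r s} → r ≢ s → ∀ w → n ≤ dist r w + dist s w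
  dist-two-centres {r} {s} r≢s (inj₁ y) with y ≟ᶠ r | y ≟ᶠ s
  ... | yes refl | yes refl = ⊥-elim (r≢s refl)
  ... | yes _    | no _     = ≤-refl
  ... | no _     | yes _    = m≤m+n n 0
  ... | no _     | no _     = m≤m+n n n
  dist-two-centres {r} {s} r≢s (inj₂ (e , i)) =
    offset-two-centres (ex e ≟ᶠ r) (ey e ≟ᶠ r) (ex e ≟ᶠ s) (ey e ≟ᶠ s) r≢s (suc (toℕ i)) (<⇒≤ (internal<n i))

  Near : Fin N → Vertex → Set
  Near r w = dist r w < n

  near-vertex : ∀ {r y} → Near r (inj₁ y) → y ≡ r
  near-vertex {r} {y} near with y ≟ᶠ r
  ... | yes y≡r = y≡r
  ... | no _    = ⊥-elim (<-irrefl refl near)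

  near-internal : ∀ {r e i} → Near r (inj₂ (e , i)) → Incident r e
  near-internal {r} {e} near with ex e ≟ᶠ r | ey e ≟ᶠ r
  ... | yes ex≡r | _        = inj₁ ex≡r
  ... | no _     | yes ey≡r = inj₂ ey≡r
  ... | no _     | no _     = ⊥-elim (<-irrefl refl near)

  incident⇒near : ∀ {r e} i → Incident r e → Near r (inj₂ (e , i))
  incident⇒near {r} {e} i incident with ex e ≟ᶠ r | ey e ≟ᶠ r | incident
  ... | yes _ | _     | _ = internal<n i
  ... | no _  | yes _ | _ = ∸-monoʳ-< z<s (<⇒≤ (internal<n i))
  ... | no ex≢r | no _ | inj₁ ex≡r = ⊥-elim (ex≢r ex≡r)
  ... | no _ | no ey≢r | inj₂ ey≡r = ⊥-elim (ey≢r ey≡r)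

  SameEdge-near : ∀ {r u v} → SameEdge u v → Near r u → Near r v
  SameEdge-near {r} (e , i , j , refl , refl) near = incident⇒near {r} {e} j (near-internal {e = e} near)

  near-two-centres⇒same-edge : ∀ {r s u v} → r ≢ s → Near r u → Near s u → Near r v → Near s v → SameEdge u v
  near-two-centres⇒same-edge {u = inj₁ _} r≢s ru su _ _ =
    ⊥-elim (r≢s (trans (sym (near-vertex ru)) (near-vertex su)))
  near-two-centres⇒same-edge {u = inj₂ _} {inj₁ _} r≢s _ _ rv sv =
    ⊥-elim (r≢s (trans (sym (near-vertex rv)) (near-vertex sv)))
  near-two-centres⇒same-edge {u = inj₂ (e , i)} {inj₂ (f , j)} r≢s ru su rv sv
    with edge-unique {e = e} {f} r≢s (near-internal {e = e} ru) (near-internal {e = e} su)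
                                     (near-internal {e = f} rv) (near-internal {e = f} sv)
  ... | refl = e , i , j , refl , refl

  Within-sym : ∀ {L u v} → Within L u v → Within L v u
  Within-sym (l , l≤L , w) = l , l≤L , reverseʷ ~-sym w

  walk-up-edge : ∀ e p k → p + k ≤ n → Walk _~_ k (pt G n e p) (pt G n e (p + k))
  walk-up-edge e p zero _ = subst (λ q → Walk _~_ 0 (pt G n e p) (pt G n e q)) (sym (+-identityʳ p)) here
  walk-up-edge e p (suc k) p+1+k≤n =
    step (e , p , <-≤-trans (m<m+n p z<s) p+1+k≤n , inj₁ (refl , refl))
         (subst (λ q → Walk _~_ k (pt G n e (suc p)) (pt G n e q)) (sym (+-suc p k))
                (walk-up-edge e (suc p) k (subst (_≤ n) (+-suc p k) p+1+k≤n)))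

  walk-forward : ∀ {L} e {p q} → p ≤ q → q ≤ n → q ≤ L + p → Within L (pt G n e p) (pt G n e q)
  walk-forward {L} e {p} {q} p≤q q≤n q≤L+p =
    q ∸ p ,
    m≤n+o⇒m∸n≤o q p (subst (q ≤_) (+-comm L p) q≤L+p) ,
    subst (λ t → Walk _~_ (q ∸ p) (pt G n e p) (pt G n e t)) (m+[n∸m]≡n p≤q)
          (walk-up-edge e p (q ∸ p) (subst (_≤ n) (sym (m+[n∸m]≡n p≤q)) q≤n))

  walk-along-edge : ∀ {L} e {p q} → p ≤ n → q ≤ n → p ≤ L + q → q ≤ L + p → Within L (pt G n e p) (pt G n e q)
  walk-along-edge e {p} {q} p≤n q≤n p≤L+q q≤L+p with ≤-total p q
  ... | inj₁ p≤q = walk-forward e p≤q q≤n q≤L+p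
  ... | inj₂ q≤p = Within-sym (walk-forward e q≤p p≤n p≤L+q)

  internal-within : ∀ {L e i j} → suc (toℕ i) ≤ L + suc (toℕ j) → suc (toℕ j) ≤ L + suc (toℕ i) →
                    Within L (inj₂ (e , i)) (inj₂ (e , j))
  internal-within {L} {e} {i} {j} i≤L+j j≤L+i =
    subst₂ (Within L) (pt-internal e i) (pt-internal e j)
           (walk-along-edge e (<⇒≤ (internal<n i)) (<⇒≤ (internal<n j)) i≤L+j j≤L+i)

  walk-to-centre : ∀ r w → Near r w → Walk _~_ (dist r w) w (inj₁ r)
  walk-to-centre r (inj₁ y) near with near-vertex near
  ... | refl = subst (λ d → Walk _~_ d (inj₁ r) (inj₁ r)) (sym (dist-centre r)) here
  walk-to-centre r (inj₂ (e , i)) near with ex e ≟ᶠ r | ey e ≟ᶠ r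
  ... | yes refl | _ =
    subst (λ u → Walk _~_ (suc (toℕ i)) u (inj₁ (ex e))) (pt-internal e i)
          (reverseʷ ~-sym (walk-up-edge e 0 (suc (toℕ i)) (<⇒≤ (internal<n i))))
  ... | no _ | yes refl =
    subst₂ (Walk _~_ (n ∸ suc (toℕ i))) (pt-internal e i) (pt-last e _ i+[n∸i]≡n)
           (walk-up-edge e (suc (toℕ i)) (n ∸ suc (toℕ i)) (≤-reflexive i+[n∸i]≡n))
    where
    i+[n∸i]≡n : suc (toℕ i) + (n ∸ suc (toℕ i)) ≡ n
    i+[n∸i]≡n = m+[n∸m]≡n (<⇒≤ (internal<n i))
  ... | no _ | no _ = ⊥-elim (<-irrefl refl near)

  within-via-centre : ∀ {L r u v} → Through L r u v → L < n → Within L u v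
  within-via-centre {L} {r} {u} {v} (through bound) L<n =
    dist r u + dist r v , bound ,
    walk-to-centre r u (≤-<-trans (≤-trans (m≤m+n _ _) bound) L<n) ++ʷ
    reverseʷ ~-sym (walk-to-centre r v (≤-<-trans (≤-trans (m≤n+m _ _) bound) L<n))

  pt-injective : ∀ e {p q} → p ≤ n → q ≤ n → pt G n e p ≡ pt G n e q → p ≡ q
  pt-injective e {p} {q} p≤n q≤n eq = begin
    p                         ≡⟨ offset-from-ex e p ⟨
    offsetFrom (ex e) e p     ≡⟨ dist-pt (ex e) e p p≤n ⟨
    dist (ex e) (pt G n e p)  ≡⟨ cong (dist (ex e)) eq ⟩
    dist (ex e) (pt G n e q)  ≡⟨ dist-pt (ex e) e q q≤n ⟩
    offsetFrom (ex e) e q     ≡⟨ offset-from-ex e q ⟩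
    q                         ∎
    where open ≡-Reasoning

  dist-injective-on-edge : ∀ {r e i j} → Near r (inj₂ (e , i)) →
                           dist r (inj₂ (e , i)) ≡ dist r (inj₂ (e , j)) → i ≡ j
  dist-injective-on-edge {r} {e} {i} {j} near eq with ex e ≟ᶠ r | ey e ≟ᶠ r
  ... | yes _ | _     = toℕ-injective (suc-injective eq)
  ... | no _  | yes _ = toℕ-injective (suc-injective (∸-cancelˡ-≡ (<⇒≤ (internal<n i)) (<⇒≤ (internal<n j)) eq))
  ... | no _  | no _  = ⊥-elim (<-irrefl refl near)

  dist-internal-positive : ∀ {r e i} → 0 < n → 0 < dist r (inj₂ (e , i))
  dist-internal-positive {r} {e} {i} 0<n with ex e ≟ᶠ r | ey e ≟ᶠ r
  ... | yes _ | _     = z<s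
  ... | no _  | yes _ = m<n⇒0<n∸m (internal<n i)
  ... | no _  | no _  = 0<n

  dist≡0⇒centre : ∀ {r w} → 0 < n → dist r w ≡ 0 → w ≡ inj₁ r
  dist≡0⇒centre {r} {inj₁ y} 0<n d≡0 = cong inj₁ (near-vertex {r} (subst (_< n) (sym d≡0) 0<n))
  dist≡0⇒centre {r} {inj₂ (e , i)} 0<n d≡0 = ⊥-elim (<⇒≢ (dist-internal-positive {r} {e} {i} 0<n) (sym d≡0))

  near-positive⇒internal : ∀ {r w} → Near r w → 0 < dist r w → ∃[ e ] ∃[ i ] (w ≡ inj₂ (e , i))
  near-positive⇒internal {r} {inj₁ y} near 0<d with near-vertex {r} near
  ... | refl = ⊥-elim (<⇒≢ 0<d (sym (dist-centre r)))
  near-positive⇒internal {w = inj₂ (e , i)} _ _ = e , i , refl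

module Balls (G : Graph) {n m : ℕ} (m<n : m < n) where
  open Subdivision G n

  near-left : ∀ {L r u v} → Through L r u v → L ≤ m → Near r u
  near-left {r = r} {v = v} (through bound) L≤m = ≤-<-trans (≤-trans (m≤m+n _ (dist r v)) (≤-trans bound L≤m)) m<n

  near-right : ∀ {L r u v} → Through L r u v → L ≤ m → Near r v
  near-right {r = r} {u} (through bound) L≤m = ≤-<-trans (≤-trans (m≤n+m _ (dist r u)) (≤-trans bound L≤m)) m<n

  escape : ∀ {s L u v} → Walk _~_ L u v → L ≤ m → Near s u → ¬ Near s v →
           ∃[ r ] (r ≢ s × Through L r u v)
  escape {s} w L≤m su ¬sv with walk-dichotomy w
  ... | inj₁ same = ⊥-elim (¬sv (SameEdge-near same su))
  ... | inj₂ (r , via) with r ≟ᶠ s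
  ...   | yes refl = ⊥-elim (¬sv (near-right via L≤m))
  ...   | no r≢s   = r , r≢s , via

  -- Two distinct centres are at total distance ≥ n from any vertex, so 3n ≤ 3m.
  no-short-triangle : ∀ {a b c u v w} → a ≢ b → a ≢ c → b ≢ c →
    Through m a u v → Through m b u w → Through m c w v → ⊥
  no-short-triangle {a} {b} {c} {u} {v} {w} a≢b a≢c b≢c (through uv) (through uw) (through wv) =
    <-irrefl refl (begin-strict
      m + m + m
        <⟨ +-mono-<-≤ (+-mono-< m<n m<n) (<⇒≤ m<n) ⟩
      n + n + n
        ≤⟨ +-mono-≤ (+-mono-≤ (dist-two-centres a≢b u) (dist-two-centres a≢c v)) (dist-two-centres b≢c w) ⟩
      (dist a u + dist b u) + (dist a v + dist c v) + (dist b w + dist c w)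
        ≡⟨ regroup (dist a u) (dist b u) (dist a v) (dist c v) (dist b w) (dist c w) ⟩
      (dist a u + dist a v) + (dist b u + dist b w) + (dist c w + dist c v)
        ≤⟨ +-mono-≤ (+-mono-≤ uv uw) wv ⟩
      m + m + m ∎)
    where
    open ≤-Reasoning
    regroup : ∀ p q r s t u → (p + q) + (r + s) + (t + u) ≡ (p + r) + (q + t) + (u + s)
    regroup = solve-∀

  no-triangle-escaping-both-ends : ∀ {e i v w} →
    Within m (inj₂ (e , i)) v → Within m (inj₂ (e , i)) w → Within m w v →
    ¬ Near (ex e) v → ¬ Near (ey e) w → ⊥
  no-triangle-escaping-both-ends {e} {i} (L₁ , L₁≤m , uv) (L₂ , L₂≤m , uw) (L₃ , L₃≤m , wv) ¬ex-v ¬ey-w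
    with escape uv L₁≤m (incident⇒near {e = e} i (inj₁ refl)) ¬ex-v
       | escape uw L₂≤m (incident⇒near {e = e} i (inj₂ refl)) ¬ey-w
  ... | r₁ , r₁≢ex , b₁ | r₂ , r₂≢ey , b₂
    with near-internal {e = e} (near-left b₁ L₁≤m) | near-internal {e = e} (near-left b₂ L₂≤m)
  ... | inj₁ ex≡r₁ | _          = r₁≢ex (sym ex≡r₁)
  ... | _          | inj₂ ey≡r₂ = r₂≢ey (sym ey≡r₂)
  ... | inj₂ refl  | inj₁ refl with escape wv L₃≤m (near-right b₂ L₂≤m) ¬ex-v
  ...   | r₃ , r₃≢ex , b₃ =
    no-short-triangle (ex≢ey e ∘ sym) ey≢r₃ (r₃≢ex ∘ sym)
                      (Through-≤ L₁≤m b₁) (Through-≤ L₂≤m b₂) (Through-≤ L₃≤m b₃)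
    where
    ey≢r₃ : ey e ≢ r₃
    ey≢r₃ refl = ¬ey-w (near-left b₃ L₃≤m)

  IsClique : ∀ {k} → (Fin k → Vertex) → Set
  IsClique K = ∀ i j → i ≢ j → FracPow G m n (K i) (K j)

  clique-within : ∀ {k} {K : Fin k → Vertex} → IsClique K → ∀ i j → Within m (K i) (K j)
  clique-within clique i j with i ≟ᶠ j
  ... | yes refl = 0 , z≤n , here
  ... | no i≢j   = proj₂ (clique i j i≢j)

  clique-in-ball : ∀ {k} (K : Fin (suc k) → Vertex) → IsClique K → ∃[ x ] (∀ i → Near x (K i))
  clique-in-ball K clique with K fzero in K₀≡
  ... | inj₁ y = y , λ i → near-y (from₀ i)
    where
    from₀ : ∀ i → Within m (inj₁ y) (K i)
    from₀ i = subst (λ u → Within m u (K i)) K₀≡ (clique-within clique fzero i)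
    near-y : ∀ {v} → Within m (inj₁ y) v → Near y v
    near-y (L , L≤m , w) = ≤-<-trans (≤-trans (dist-from-centre y w) L≤m) m<n
  ... | inj₂ (e , i₀) with all? (λ i → dist (ex e) (K i) <? n)
  ...   | yes all-near-ex = ex e , all-near-ex
  ...   | no ¬all-near-ex = ey e , near-ey
    where
    from₀ : ∀ i → Within m (inj₂ (e , i₀)) (K i)
    from₀ i = subst (λ u → Within m u (K i)) K₀≡ (clique-within clique fzero i)
    far-from-ex : ∃[ i ] ¬ Near (ex e) (K i)
    far-from-ex = ¬∀⟶∃¬ _ _ (λ i → dist (ex e) (K i) <? n) ¬all-near-ex
    near-ey : ∀ j → Near (ey e) (K j)
    near-ey j with dist (ey e) (K j) <? n
    ... | yes near = near
    ... | no ¬near = ⊥-elim (no-triangle-escaping-both-ends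
                              (from₀ (proj₁ far-from-ex)) (from₀ j) (clique-within clique j (proj₁ far-from-ex))
                              (proj₂ far-from-ex) ¬near)

module Stretch (G : Graph) {n m : ℕ} (m<n : m < n) (x : Fin (Graph.N G)) where
  module S  = Subdivision G n
  module S′ = Subdivision G (n + m + 1)
  open Balls G m<n using (near-left; near-right)

  -- The m + 1 new vertices of each edge are put at the end away from x, so that
  -- the ball of radius < n around x is copied isometrically.
  shiftBy : ∀ {A : Set} → Dec A → ℕ
  shiftBy (yes _) = suc m
  shiftBy (no _)  = 0

  shift : Edge G → ℕ
  shift e = shiftBy (S.ey e ≟ᶠ x)

  shift≤1+m : ∀ e → shift e ≤ suc m
  shift≤1+m e with S.ey e ≟ᶠ x
  ... | yes _ = ≤-refl
  ... | no _  = z≤n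

  shifted<n′ : ∀ e (i : Fin (n ∸ 1)) → toℕ i + shift e < n + m + 1 ∸ 1
  shifted<n′ e i = shift-bound n (toℕ<n i) (shift≤1+m e)
    where
    shift-bound : ∀ a {t d} → t < a ∸ 1 → d ≤ suc m → t + d < a + m + 1 ∸ 1
    shift-bound (suc a) t<a d≤1+m =
      ≤-trans (+-mono-≤ t<a d≤1+m) (≤-reflexive (trans (+-suc a m) (+-comm 1 (a + m))))

  shiftIndex : ∀ e → Fin (n ∸ 1) → Fin (n + m + 1 ∸ 1)
  shiftIndex e i = fromℕ< (shifted<n′ e i)

  toℕ-shiftIndex : ∀ e i → toℕ (shiftIndex e i) ≡ toℕ i + shift e
  toℕ-shiftIndex e i = toℕ-fromℕ< (shifted<n′ e i)

  stretch : S.Vertex → S′.Vertex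
  stretch (inj₁ y)       = inj₁ y
  stretch (inj₂ (e , i)) = inj₂ (e , shiftIndex e i)

  stretch-injective : ∀ {u v} → stretch u ≡ stretch v → u ≡ v
  stretch-injective {inj₁ y} {inj₁ .y} refl = refl
  stretch-injective {inj₂ (e , i)} {inj₂ (f , j)} eq with ,-injectiveˡ (inj₂-injective eq)
  ... | refl = cong (λ k → inj₂ (e , k)) (toℕ-injective (+-cancelʳ-≡ (shift e) (toℕ i) (toℕ j) same-shifted))
    where
    same-shifted : toℕ i + shift e ≡ toℕ j + shift e
    same-shifted = trans (sym (toℕ-shiftIndex e i))
                         (trans (cong toℕ (,-injectiveʳ (inj₂-injective eq))) (toℕ-shiftIndex e j))

  offset-shift : ∀ e t (a : Dec (S.ex e ≡ x)) (b : Dec (S.ey e ≡ x)) → S.offset a b (suc t) < n →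
                 S′.offset a b (suc (t + shiftBy b)) ≡ S.offset a b (suc t)
  offset-shift e t (yes a) (yes b) _ = ⊥-elim (S.ex≢ey e (trans a (sym b)))
  offset-shift e t (yes _) (no _)  _ = cong suc (+-identityʳ t)
  offset-shift e t (no _)  (yes _) _ =
    trans (cong₂ _∸_ (reorder₁ n m) (reorder₂ t m)) ([m+n]∸[m+o]≡n∸o (suc m) n (suc t))
    where
    reorder₁ : ∀ n m → n + m + 1 ≡ suc m + n
    reorder₁ = solve-∀
    reorder₂ : ∀ t m → suc (t + suc m) ≡ suc m + suc t
    reorder₂ = solve-∀
  offset-shift e t (no _)  (no _)  far = ⊥-elim (<-irrefl refl far)

  dist-stretch : ∀ w → S.Near x w → S′.dist x (stretch w) ≡ S.dist x w
  dist-stretch (inj₁ y) near with S.near-vertex near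
  ... | refl = trans (S′.dist-centre x) (sym (S.dist-centre x))
  dist-stretch (inj₂ (e , i)) near =
    trans (cong (λ t → S′.offsetFrom x e (suc t)) (toℕ-shiftIndex e i))
          (offset-shift e (toℕ i) (S.ex e ≟ᶠ x) (S.ey e ≟ᶠ x) near)

  stretch-same-edge : ∀ {L u v} → S.SameEdge u v → L ≤ m → Walk S._~_ L u v →
                      S′.Within m (stretch u) (stretch v)
  stretch-same-edge {L} (e , i , j , refl , refl) L≤m w =
    S′.internal-within {e = e} (shifted (S.same-edge-walk-bound (reverseʷ S.~-sym w)))
                               (shifted (S.same-edge-walk-bound w))
    where
    shifted : ∀ {a b} → suc (toℕ a) ≤ L + suc (toℕ b) → suc (toℕ (shiftIndex e a)) ≤ m + suc (toℕ (shiftIndex e b))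
    shifted {a} {b} a≤L+b =
      subst₂ (λ p q → suc p ≤ m + suc q) (sym (toℕ-shiftIndex e a)) (sym (toℕ-shiftIndex e b))
             (≤-trans (+-monoˡ-≤ (shift e) (≤-trans a≤L+b (+-monoˡ-≤ _ L≤m))) (≤-reflexive (+-assoc m _ (shift e))))

  stretch-preserves : ∀ {u v} → S.Near x u → S.Near x v → FracPow G m n u v →
                      FracPow G m (n + m + 1) (stretch u) (stretch v)
  stretch-preserves {u} {v} x-u x-v (u≢v , L , L≤m , w) = u≢v ∘ stretch-injective , within
    where
    within : S′.Within m (stretch u) (stretch v)
    within with S.walk-dichotomy w
    ... | inj₁ same = stretch-same-edge same L≤m w
    ... | inj₂ (r , via) with r ≟ᶠ x
    ...   | yes refl = S′.within-via-centre
                         (S′.through (subst₂ (λ a b → a + b ≤ m) (sym (dist-stretch u x-u)) (sym (dist-stretch v x-v))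
                                             (S.Through.bound (S.Through-≤ L≤m via))))
                         (m<n+m+1 n m)
    ...   | no r≢x   = stretch-same-edge
                         (S.near-two-centres⇒same-edge r≢x (near-left via L≤m) x-u (near-right via L≤m) x-v) L≤m w

module Squash (G : Graph) {n m : ℕ} (m<n : m < n) where
  module S  = Subdivision G n
  module S′ = Subdivision G (n + m + 1)

  m<n′ : m < n + m + 1
  m<n′ = m<n+m+1 n m

  -- Positions 0 … m of an edge are kept and positions m + 1 … n + m + 1 are
  -- moved down by m + 1, so each edge of the longer subdivision wraps once
  -- around its first m + 1 vertices.
  fold : ℕ → ℕ
  fold q with q ≤? m
  ... | yes _ = q
  ... | no _  = q ∸ suc m

  fold-id : ∀ {q} → q ≤ m → fold q ≡ q
  fold-id {q} q≤m with q ≤? m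
  ... | yes _   = refl
  ... | no q≰m = ⊥-elim (q≰m q≤m)

  n′∸[1+m]≡n : n + m + 1 ∸ suc m ≡ n
  n′∸[1+m]≡n = trans (cong (_∸ suc m) (trans (+-assoc n m 1) (cong (n +_) (+-comm m 1)))) (m+n∸n≡m n (suc m))

  fold≤n : ∀ {q} → q ≤ n + m + 1 → fold q ≤ n
  fold≤n {q} q≤n′ with q ≤? m
  ... | yes q≤m = ≤-trans q≤m (<⇒≤ m<n)
  ... | no _    = subst (q ∸ suc m ≤_) n′∸[1+m]≡n (∸-monoˡ-≤ (suc m) q≤n′)

  fold-≤ : ∀ {p q} → p ≤ m + q → fold p ≤ m + fold q
  fold-≤ {p} {q} p≤m+q with p ≤? m | q ≤? m
  ... | yes p≤m | _       = ≤-trans p≤m (m≤m+n m _)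
  ... | no _    | yes _   = ≤-trans (m∸n≤m p (suc m)) p≤m+q
  ... | no _    | no q≰m = subst (p ∸ suc m ≤_) (+-∸-assoc m (≰⇒> q≰m)) (∸-monoˡ-≤ (suc m) p≤m+q)

  far-apart : ∀ {q} → m < q → ¬ (q ≤ m + (q ∸ suc m))
  far-apart {q} m<q q≤ = <-irrefl refl (subst (_≤ m + (q ∸ suc m)) (sym (m+[n∸m]≡n m<q)) q≤)

  fold-injective : ∀ {p q} → p ≤ m + q → q ≤ m + p → fold p ≡ fold q → p ≡ q
  fold-injective {p} {q} p≤m+q q≤m+p eq with p ≤? m | q ≤? m
  ... | yes _   | yes _   = eq
  ... | yes _   | no q≰m = ⊥-elim (far-apart (≰⇒> q≰m) (subst (λ t → q ≤ m + t) eq q≤m+p))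
  ... | no p≰m | yes _   = ⊥-elim (far-apart (≰⇒> p≰m) (subst (λ t → p ≤ m + t) (sym eq) p≤m+q))
  ... | no p≰m | no q≰m = ∸-cancelʳ-≡ (≰⇒> p≰m) (≰⇒> q≰m) eq

  squash : S′.Vertex → S.Vertex
  squash (inj₁ y)       = inj₁ y
  squash (inj₂ (e , i)) = pt G n e (fold (suc (toℕ i)))

  offset-fold : ∀ {q} {A B : Set} (a : Dec A) (b : Dec B) → S′.offset a b q ≤ m →
                S.offset a b (fold q) ≡ S′.offset a b q
  offset-fold (yes _) _ q≤m = fold-id q≤m
  offset-fold {q} (no _) (yes _) n′∸q≤m with q ≤? m
  ... | yes q≤m = ⊥-elim (<-irrefl refl (begin-strict
    n              <⟨ n<1+n n ⟩
    suc n          ≡⟨ m+n∸m≡n m (suc n) ⟨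
    m + suc n ∸ m  ≡⟨ cong (_∸ m) (reorder n m) ⟩
    n + m + 1 ∸ m  ≤⟨ ∸-monoʳ-≤ (n + m + 1) q≤m ⟩
    n + m + 1 ∸ q  ≤⟨ n′∸q≤m ⟩
    m              <⟨ m<n ⟩
    n              ∎))
    where
    open ≤-Reasoning
    reorder : ∀ n m → m + suc n ≡ n + m + 1
    reorder = solve-∀
  ... | no q≰m = sym (trans (cong₂ _∸_ (reorder n m) (sym (m+[n∸m]≡n (≰⇒> q≰m))))
                             ([m+n]∸[m+o]≡n∸o (suc m) n (q ∸ suc m)))
    where
    reorder : ∀ n m → n + m + 1 ≡ suc m + n
    reorder = solve-∀
  offset-fold (no _) (no _) n′≤m = ⊥-elim (<-irrefl refl (≤-<-trans n′≤m m<n′))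

  dist-squash : ∀ r w → S′.dist r w ≤ m → S.dist r (squash w) ≡ S′.dist r w
  dist-squash r (inj₁ y) d≤m with y ≟ᶠ r
  ... | yes _ = refl
  ... | no _  = ⊥-elim (<-irrefl refl (≤-<-trans d≤m m<n′))
  dist-squash r (inj₂ (e , i)) d≤m =
    trans (S.dist-pt r e _ (fold≤n (<⇒≤ (S′.internal<n i))))
          (offset-fold (S.ex e ≟ᶠ r) (S.ey e ≟ᶠ r) d≤m)

  near-squash : ∀ {r w} → S′.dist r w ≤ m → S.Near r (squash w)
  near-squash {r} {w} d≤m = subst (_< n) (sym (dist-squash r w d≤m)) (≤-<-trans d≤m m<n)

  squash-separates : ∀ r {u v} → S′.dist r u ≤ m → S′.dist r v ≤ m → squash u ≡ squash v → u ≡ v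
  squash-separates r {inj₁ y} {v} du dv eq with S′.near-vertex {r} (≤-<-trans du m<n′)
  ... | refl = sym (S′.dist≡0⇒centre (≤-<-trans z≤n m<n′) (begin
    S′.dist r v          ≡⟨ dist-squash r v dv ⟨
    S.dist r (squash v)  ≡⟨ cong (S.dist r) eq ⟨
    S.dist r (inj₁ r)    ≡⟨ S.dist-centre r ⟩
    0                    ∎))
    where open ≡-Reasoning
  squash-separates r {inj₂ _} {inj₁ _} du dv eq = sym (squash-separates r dv du (sym eq))
  squash-separates r {inj₂ (e , i)} {inj₂ (f , j)} du dv eq
    with S.near-positive⇒internal (near-squash {r} {inj₂ (e , i)} du)
           (subst (0 <_) (sym (dist-squash r (inj₂ (e , i)) du))
                  (S′.dist-internal-positive {r} {e} {i} (≤-<-trans z≤n m<n′)))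
  ... | g , k , image≡ with S.pt≡internal⇒edge e (fold (suc (toℕ i))) image≡
                           | S.pt≡internal⇒edge f (fold (suc (toℕ j))) (trans (sym eq) image≡)
  ... | refl | refl =
    cong (λ l → inj₂ (e , l)) (S′.dist-injective-on-edge {r} {e} {i} {j} (≤-<-trans du m<n′) same-dist)
    where
    same-dist : S′.dist r (inj₂ (e , i)) ≡ S′.dist r (inj₂ (e , j))
    same-dist = trans (sym (dist-squash r (inj₂ (e , i)) du))
                      (trans (cong (S.dist r) eq) (dist-squash r (inj₂ (e , j)) dv))

  squash-homomorphism : ∀ {u v} → FracPow G m (n + m + 1) u v → FracPow G m n (squash u) (squash v)
  squash-homomorphism {u} {v} (u≢v , L , L≤m , w) with S′.walk-dichotomy w
  ... | inj₁ (e , i , j , refl , refl) =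
    folds-differ ∘ S.pt-injective e (fold≤n (on-edge i)) (fold≤n (on-edge j)) ,
    S.walk-along-edge e (fold≤n (on-edge i)) (fold≤n (on-edge j)) (fold-≤ i≤m+j) (fold-≤ j≤m+i)
    where
    on-edge : ∀ k → suc (toℕ k) ≤ n + m + 1
    on-edge k = <⇒≤ (S′.internal<n k)
    i≤m+j : suc (toℕ i) ≤ m + suc (toℕ j)
    i≤m+j = ≤-trans (S′.same-edge-walk-bound (reverseʷ S′.~-sym w)) (+-monoˡ-≤ _ L≤m)
    j≤m+i : suc (toℕ j) ≤ m + suc (toℕ i)
    j≤m+i = ≤-trans (S′.same-edge-walk-bound w) (+-monoˡ-≤ _ L≤m)
    folds-differ : fold (suc (toℕ i)) ≢ fold (suc (toℕ j))
    folds-differ eq =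
      u≢v (cong (λ k → inj₂ (e , k)) (toℕ-injective (suc-injective (fold-injective i≤m+j j≤m+i eq))))
  ... | inj₂ (r , S′.through bound) =
    u≢v ∘ squash-separates r du dv ,
    S.within-via-centre (S.through (subst₂ (λ a b → a + b ≤ m) (sym (dist-squash r u du)) (sym (dist-squash r v dv))
                                           (≤-trans bound L≤m)))
                        m<n
    where
    du : S′.dist r u ≤ m
    du = ≤-trans (m≤m+n _ _) (≤-trans bound L≤m)
    dv : S′.dist r v ≤ m
    dv = ≤-trans (m≤n+m _ _) (≤-trans bound L≤m)

clique-stretch : ∀ (G : Graph) {n m k} → m < n → HasClique (FracPow G m n) k → HasClique (FracPow G m (n + m + 1)) k
clique-stretch G {k = zero}  m<n _ = (λ ()) , (λ ())
clique-stretch G {k = suc k} m<n (K , clique) with Balls.clique-in-ball G m<n K clique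
... | x , near = stretch ∘ K , λ i j i≢j → stretch-preserves (near i) (near j) (clique i j i≢j)
  where open Stretch G m<n x

lemma1 : (G : Graph) (n m : ℕ) → m < n →
    ChiEqOmega (FracPow G m n) → ChiEqOmega (FracPow G m (n + m + 1))
lemma1 G n m m<n =
  ChiEqOmega-transfer (Colorable-pullback squash squash-homomorphism) (clique-stretch G m<n)
  where open Squash G m<n
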